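{- Let $D=(V,A)$ be an AUSO of the graph of a simple $4$-polytope, let $v_{\mathrm{st}}\in V$ be an arbitrary starting vertex, and let $\lambda:V\to\mathbb{Z}$ be an effectively decreasing function on $D$. Then the expected number of pivot steps of the random edge algorithm started at $v_{\mathrm{st}}$ until it reaches the global sink of $D$ is at most $4\,|\lambda(V)|$.
   Context: An orientation $D$ of the graph (1-skeleton) of a polytope $P$ is an acyclic unique sink orientation (AUSO) if $D$ is acyclic and for every nonempty face $F$ of $P$ the subgraph of $D$ induced by the vertices of $F$ has a unique sink; the global sink is the unique sink of $D$. A polytope is simple if each vertex lies in exactly $d$ facets; for a simple $4$-polytope every vertex has degree $4$ in the graph. A function $\lambda:V\to\mathbb{Z}$ is monotone decreasing on $D$ if $\lambda(v)\ge\lambda(w)$ for every arc $(v,w)\in A$; it is effectively decreasing if it is monotone decreasing and every vertex $v\in V$ that is not the global sink has an outgoing arc $(v,w)\in A$ with $\lambda(v)>\lambda(w)$. The random edge algorithm: at the current vertex, if it is not the global sink, move along an outgoing arc chosen uniformly at random among its outgoing arcs; a pivot step is one such move.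
   Formalization: The simple 4-polytope is taken in ℚ⁴, with rational vertex coordinates. -}

module Defs where

open import Data.Nat using (ℕ; zero; suc)
open import Data.Integer as ℤ using (ℤ; +_)
open import Data.Rational using (ℚ; _+_; _*_; _≤_; _<_; _/_; 0ℚ; 1ℚ)
open import Data.Fin using (Fin)
open import Data.Fin.Properties using () renaming (_≟_ to _≟ᶠ_)
open import Data.Vec using (Vec; []; _∷_)
open import Data.List using (List; []; _∷_; length; map; filter; deduplicate; sum; foldr)
open import Data.List.Base using (allFin)
open import Data.Bool using (Bool; true; false; T)
open import Data.Product using (Σ; ∃; _×_; _,_)
open import Data.Sum using (_⊎_)
open import Data.Empty using (⊥)
open import Relation.Nullary using (¬_)
open import Relation.Binary.PropositionalEquality using (_≡_; _≢_)
open import Relation.Binary.Construct.Closure.Transitive using (TransClosure)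
open import Function.Bundles using (_⇔_)

-- Geometry in ℚ⁴.  A polytope is given in V-representation: a finite
-- family  pt : Fin n → ℚ⁴  of points, P = conv (pt).

ℚ⁴ : Set
ℚ⁴ = Vec ℚ 4

dot : ℚ⁴ → ℚ⁴ → ℚ
dot (a₀ ∷ a₁ ∷ a₂ ∷ a₃ ∷ []) (b₀ ∷ b₁ ∷ b₂ ∷ b₃ ∷ []) =
  a₀ * b₀ + a₁ * b₁ + a₂ * b₂ + a₃ * b₃

zero⁴ : ℚ⁴
zero⁴ = 0ℚ ∷ 0ℚ ∷ 0ℚ ∷ 0ℚ ∷ []

module Polytope {n : ℕ} (pt : Fin n → ℚ⁴) where

  -- the face of P cut out by the linear functional c (the set of
  -- vertices maximising c); every nonempty face of P is of this form
  -- (c = 0 gives P itself), and every such set is nonempty.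
  InFace : ℚ⁴ → Fin n → Set
  InFace c i = ∀ j → dot c (pt j) ≤ dot c (pt i)

  -- every pt i is a vertex of P (and the pt i are pairwise distinct)
  VerticesInConvexPosition : Set
  VerticesInConvexPosition =
    ∀ i → ∃ λ c → ∀ j → j ≢ i → dot c (pt j) < dot c (pt i)

  FullDimensional : Set
  FullDimensional = ∀ c → (∀ i j → dot c (pt i) ≡ dot c (pt j)) → c ≡ zero⁴

  -- {i , j} is an edge (1-dimensional face) of P
  Adj : Fin n → Fin n → Set
  Adj i j = i ≢ j × ∃ λ c → dot c (pt i) ≡ dot c (pt j)
                        × (∀ k → k ≢ i → k ≢ j → dot c (pt k) < dot c (pt i))

  SameFace : ℚ⁴ → ℚ⁴ → Set
  SameFace c c' = ∀ i → InFace c i ⇔ InFace c' i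

  IsFacet : ℚ⁴ → Set
  IsFacet c = (∃ λ j → ¬ InFace c j)
            × (∀ c' → (∀ i → InFace c i → InFace c' i)
                    → SameFace c' c ⊎ (∀ i → InFace c' i))

  Simple : Set
  Simple = ∀ i → Σ (Fin 4 → ℚ⁴) λ F →
      (∀ k → IsFacet (F k) × InFace (F k) i)
    × (∀ k l → k ≢ l → ¬ SameFace (F k) (F l))
    × (∀ c → IsFacet c → InFace c i → ∃ λ k → SameFace c (F k))

IsSimple4Polytope : {n : ℕ} → (Fin n → ℚ⁴) → Set
IsSimple4Polytope pt = VerticesInConvexPosition × FullDimensional × Simple
  where open Polytope pt

-- Orientations given by a Boolean arc relation  arc i j = true  iff
-- (i , j) ∈ A.

module Orientation {n : ℕ} (arc : Fin n → Fin n → Bool) where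

  Arc : Fin n → Fin n → Set
  Arc i j = arc i j ≡ true

  IsSink : Fin n → Set
  IsSink i = ∀ j → ¬ Arc i j

  Acyclic : Set
  Acyclic = ∀ i → ¬ TransClosure Arc i i

  MonotoneDecreasing : (Fin n → ℤ) → Set
  MonotoneDecreasing f = ∀ v w → Arc v w → f w ℤ.≤ f v

  EffectivelyDecreasing : (Fin n → ℤ) → Set
  EffectivelyDecreasing f = MonotoneDecreasing f
    × (∀ v → ¬ IsSink v → ∃ λ w → Arc v w × f w ℤ.< f v)

  outNbrs : Fin n → List (Fin n)
  outNbrs v = filter (λ w → T? (arc v w)) (allFin n)
    where
    open import Relation.Nullary.Decidable using (Dec)
    open import Data.Bool.Properties using (T?)

  -- E k v = expected value of min(T, k), where T is the number of pivot
  -- steps of random edge started at v until it reaches a sink.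
  expectedTrunc : ℕ → Fin n → ℚ
  expectedTrunc zero v = 0ℚ
  expectedTrunc (suc k) v with outNbrs v
  ... | [] = 0ℚ
  ... | w ∷ ws = 1ℚ + sum' (map (expectedTrunc k) (w ∷ ws)) * (+ 1 / suc (length ws))
    where
    sum' : List ℚ → ℚ
    sum' = foldr _+_ 0ℚ

IsAUSO : {n : ℕ} → (Fin n → ℚ⁴) → (Fin n → Fin n → Bool) → Set
IsAUSO {n} pt arc =
    (∀ i j → Arc i j → Adj i j)
  × (∀ i j → Adj i j → (Arc i j × ¬ Arc j i) ⊎ (Arc j i × ¬ Arc i j))
  × Acyclic
  × (∀ c → Σ (Fin n) λ s → (InFace c s × (∀ j → InFace c j → ¬ Arc s j))
          × (∀ s' → InFace c s' → (∀ j → InFace c j → ¬ Arc s' j) → s' ≡ s))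
  where
  open Polytope pt
  open Orientation arc

imageSize : {n : ℕ} → (Fin n → ℤ) → ℕ
imageSize {n} f = length (deduplicate ℤ._≟_ (map f (allFin n)))

-- Let rank x be the number of values of λ that are at most λ x.  The rank never increases
-- along an arc and, λ being effectively decreasing, strictly decreases along some arc out of
-- every non-sink.  If all out-degrees are at most d, random edge therefore leaves x along a
-- rank-decreasing arc with probability at least 1/d, and induction on the truncation k gives
-- E_k(x) ≤ 1 + d (L · rank x − 1) / L ≤ d · rank x, where L ≤ d is the out-degree of x.
--
-- It remains to see that a vertex v of a simple 4-polytope P has at most 4 neighbours.  A
-- Farkas-type argument (induction on the number of vertices off the face of a functional,
-- tilting it until its face grows) shows that every linear functional maximised at v agrees on P
-- with a nonnegative combination of the normals of the four facets through v.  Consequently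
-- every edge at v leaves exactly one of these facets, and distinct edges leave distinct facets.
module Submission where

open import Defs
open import Data.Nat using (ℕ)
open import Data.Fin using (Fin)
open import Data.Bool using (Bool)

module Counting where
  open import Data.Nat using (ℕ; suc; _*_; _≤_; _<_; z≤n; s≤s; _≤?_)
  open import Data.Nat.Properties using (m≤n⇒m≤1+n; +-mono-≤; +-suc; ≰⇒>)
  open import Data.Fin using (Fin; zero; suc)
  open import Data.Fin.Properties using (pigeonhole; <⇒≢)
  open import Data.List using (List; []; _∷_; length; filter; map; lookup)
  open import Data.Nat.ListAction using (sum)
  open import Data.List.Membership.Propositional using (_∈_)
  open import Data.List.Membership.Propositional.Properties using (∈-lookup)
  open import Data.List.Relation.Unary.Any using (here; there)
  import Data.List.Relation.Unary.All as All
  open import Data.List.Relation.Unary.AllPairs using (_∷_)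
  open import Data.List.Relation.Unary.Unique.Propositional using (Unique)
  open import Data.Product using (_,_)
  open import Function using (_∘_)
  open import Relation.Nullary using (¬_; yes; no; contradiction)
  open import Level using (0ℓ)
  open import Relation.Unary using (Pred; Decidable)
  open import Relation.Binary.PropositionalEquality using (_≡_; refl; cong; sym; subst)

  module _ {A : Set} {P Q : Pred A 0ℓ} (P? : Decidable P) (Q? : Decidable Q) (P⊆Q : ∀ x → P x → Q x) where

    length-filter-mono : ∀ xs → length (filter P? xs) ≤ length (filter Q? xs)
    length-filter-mono [] = z≤n
    length-filter-mono (x ∷ xs) with P? x | Q? x
    ... | yes _  | yes _  = s≤s (length-filter-mono xs)
    ... | yes px | no ¬qx = contradiction (P⊆Q x px) ¬qx
    ... | no _   | yes _  = m≤n⇒m≤1+n (length-filter-mono xs)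
    ... | no _   | no _   = length-filter-mono xs

    length-filter-strict : ∀ {y xs} → y ∈ xs → Q y → ¬ P y → length (filter P? xs) < length (filter Q? xs)
    length-filter-strict {xs = x ∷ xs} (here refl) qy ¬py with P? x | Q? x
    ... | yes py | _      = contradiction py ¬py
    ... | no _   | yes _  = s≤s (length-filter-mono xs)
    ... | no _   | no ¬qy = contradiction qy ¬qy
    length-filter-strict {xs = x ∷ xs} (there y∈xs) qy ¬py with P? x | Q? x
    ... | yes _  | yes _  = s≤s (length-filter-strict y∈xs qy ¬py)
    ... | yes px | no ¬qx = contradiction (P⊆Q x px) ¬qx
    ... | no _   | yes _  = m≤n⇒m≤1+n (length-filter-strict y∈xs qy ¬py)
    ... | no _   | no _   = length-filter-strict y∈xs qy ¬py

  module _ {A : Set} (r : A → ℕ) {R : ℕ} where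

    sum-map-≤ : ∀ xs → (∀ {y} → y ∈ xs → r y ≤ R) → sum (map r xs) ≤ length xs * R
    sum-map-≤ [] _ = z≤n
    sum-map-≤ (x ∷ xs) r≤R = +-mono-≤ (r≤R (here refl)) (sum-map-≤ xs (r≤R ∘ there))

    sum-map-< : ∀ {z} xs → (∀ {y} → y ∈ xs → r y ≤ R) → z ∈ xs → r z < R
      → suc (sum (map r xs)) ≤ length xs * R
    sum-map-< (x ∷ xs) r≤R (here refl) rz<R = +-mono-≤ rz<R (sum-map-≤ xs (r≤R ∘ there))
    sum-map-< (x ∷ xs) r≤R (there z∈xs) rz<R = subst (_≤ length (x ∷ xs) * R) (+-suc (r x) _)
      (+-mono-≤ (r≤R (here refl)) (sum-map-< xs (r≤R ∘ there) z∈xs rz<R))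

  lookup-injective : ∀ {A : Set} {xs : List A} → Unique xs → ∀ {i j} → lookup xs i ≡ lookup xs j → i ≡ j
  lookup-injective {xs = x ∷ xs} (x∉xs ∷ u) {zero}  {zero}  _ = refl
  lookup-injective {xs = x ∷ xs} (x∉xs ∷ u) {zero}  {suc j} e = contradiction e (All.lookup x∉xs (∈-lookup j))
  lookup-injective {xs = x ∷ xs} (x∉xs ∷ u) {suc i} {zero}  e =
    contradiction (sym e) (All.lookup x∉xs (∈-lookup i))
  lookup-injective {xs = x ∷ xs} (x∉xs ∷ u) {suc i} {suc j} e = cong suc (lookup-injective u e)

  length≤-injection : ∀ {A : Set} {xs : List A} {m} → Unique xs → (f : A → Fin m)
    → (∀ {x y} → x ∈ xs → y ∈ xs → f x ≡ f y → x ≡ y) → length xs ≤ m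
  length≤-injection {xs = xs} {m} u f f-inj with length xs ≤? m
  ... | yes ≤m = ≤m
  ... | no ≰m with pigeonhole (≰⇒> ≰m) (f ∘ lookup xs)
  ...   | i , j , i<j , fi≡fj =
    contradiction (lookup-injective u (f-inj (∈-lookup i) (∈-lookup j) fi≡fj)) (<⇒≢ i<j)

module NatEmbedding where
  open import Data.Nat as ℕ using (ℕ; suc)
  open import Data.Integer as ℤ using (+_)
  import Data.Integer.Properties as ℤ
  import Data.Nat.Coprimality as Coprime
  open import Data.Rational
  open import Data.Rational.Properties
  open import Relation.Binary.PropositionalEquality

  fromℕ : ℕ → ℚ
  fromℕ m = mkℚ (+ m) 0 (Coprime.sym (Coprime.1-coprimeTo m))

  /1≡fromℕ : ∀ m → + m / 1 ≡ fromℕ m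
  /1≡fromℕ m = normalize-coprime (Coprime.sym (Coprime.1-coprimeTo m))

  fromℕ-+ : ∀ a b → fromℕ (a ℕ.+ b) ≡ fromℕ a + fromℕ b
  fromℕ-+ a b = sym (trans (cong (_/ 1) (cong₂ ℤ._+_ (ℤ.*-identityʳ (+ a)) (ℤ.*-identityʳ (+ b))))
                            (/1≡fromℕ (a ℕ.+ b)))

  fromℕ-* : ∀ a b → fromℕ (a ℕ.* b) ≡ fromℕ a * fromℕ b
  fromℕ-* a b = sym (trans (cong (_/ 1) (sym (ℤ.pos-* a b))) (/1≡fromℕ (a ℕ.* b)))

  fromℕ-mono-≤ : ∀ {a b} → a ℕ.≤ b → fromℕ a ≤ fromℕ b
  fromℕ-mono-≤ {a} {b} a≤b =
    *≤* (subst₂ ℤ._≤_ (sym (ℤ.*-identityʳ (+ a))) (sym (ℤ.*-identityʳ (+ b))) (ℤ.+≤+ a≤b))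

  fromℕ-*-1/ : ∀ l → fromℕ (suc l) * (+ 1 / suc l) ≡ 1ℚ
  fromℕ-*-1/ l = trans (cong (fromℕ (suc l) *_) (normalize-coprime (Coprime.1-coprimeTo (suc l))))
                       (*-inverseʳ (fromℕ (suc l)))

  1+average≤ : ∀ l {S} N M → S ≤ fromℕ N → suc l ℕ.+ N ℕ.≤ suc l ℕ.* M
    → 1ℚ + S * (+ 1 / suc l) ≤ fromℕ M
  1+average≤ l {S} N M S≤N L+N≤LM = begin
    1ℚ + S * w                   ≤⟨ +-monoʳ-≤ 1ℚ (*-monoʳ-≤-nonNeg w S≤N) ⟩
    1ℚ + fromℕ N * w             ≡⟨ cong (_+ fromℕ N * w) (sym (fromℕ-*-1/ l)) ⟩
    L * w + fromℕ N * w          ≡⟨ sym (*-distribʳ-+ w L (fromℕ N)) ⟩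
    (L + fromℕ N) * w            ≡⟨ cong (_* w) (sym (fromℕ-+ (suc l) N)) ⟩
    fromℕ (suc l ℕ.+ N) * w      ≤⟨ *-monoʳ-≤-nonNeg w (fromℕ-mono-≤ L+N≤LM) ⟩
    fromℕ (suc l ℕ.* M) * w      ≡⟨ cong (_* w) (fromℕ-* (suc l) M) ⟩
    L * fromℕ M * w              ≡⟨ cong (_* w) (*-comm L (fromℕ M)) ⟩
    fromℕ M * L * w              ≡⟨ *-assoc (fromℕ M) L w ⟩
    fromℕ M * (L * w)            ≡⟨ cong (fromℕ M *_) (fromℕ-*-1/ l) ⟩
    fromℕ M * 1ℚ                 ≡⟨ *-identityʳ (fromℕ M) ⟩
    fromℕ M                      ∎
    where
    open ≤-Reasoning
    L = fromℕ (suc l)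
    w = + 1 / suc l
    instance _ = normalize-nonNeg 1 (suc l)

module RandomEdge {n : ℕ} (arc : Fin n → Fin n → Bool) where
  open import Data.Nat as ℕ using (ℕ; zero; suc; z≤n)
  import Data.Nat.Properties as ℕ
  open import Data.Nat.ListAction using (sum)
  open import Data.Integer as ℤ using (ℤ)
  import Data.Integer.Properties as ℤ
  open import Data.Rational using (ℚ; _+_; 0ℚ; _≤_)
  open import Data.Rational.Properties using (≤-trans; ≤-reflexive; +-mono-≤)
  open import Data.Bool.Properties using (T?; T-≡)
  open import Data.List using (List; []; _∷_; length; map; filter; foldr; deduplicate; allFin)
  open import Data.List.Properties using (length-filter)
  open import Data.List.Membership.Propositional using (_∈_)
  open import Data.List.Membership.Propositional.Properties
    using (∈-filter⁺; ∈-filter⁻; ∈-allFin; ∈-deduplicate⁺; ∈-map⁺)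
  open import Data.List.Relation.Unary.Any using (here; there)
  open import Data.List.Relation.Unary.Unique.Propositional using (Unique)
  import Data.List.Relation.Unary.Unique.Propositional.Properties as Unique
  open import Data.Product using (proj₁; proj₂)
  open import Function using (_∘_)
  open import Function.Bundles using (Equivalence)
  open import Relation.Binary.PropositionalEquality using (refl; subst; sym; trans; cong)
  open Counting
  open NatEmbedding
  open Orientation arc

  ∈-outNbrs⁻ : ∀ {v w} → w ∈ outNbrs v → Arc v w
  ∈-outNbrs⁻ {v} w∈ = Equivalence.to T-≡ (proj₂ (∈-filter⁻ (T? ∘ arc v) {xs = allFin n} w∈))

  ∈-outNbrs⁺ : ∀ {v w} → Arc v w → w ∈ outNbrs v
  ∈-outNbrs⁺ {v} {w} a = ∈-filter⁺ (T? ∘ arc v) (∈-allFin w) (Equivalence.from T-≡ a)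

  outNbrs-unique : ∀ v → Unique (outNbrs v)
  outNbrs-unique v = Unique.filter⁺ (T? ∘ arc v) (Unique.allFin⁺ n)

  sum≤fromℕ-sum : ∀ {A : Set} d (f : A → ℚ) (r : A → ℕ) xs
    → (∀ {y} → y ∈ xs → f y ≤ fromℕ (d ℕ.* r y))
    → foldr _+_ 0ℚ (map f xs) ≤ fromℕ (d ℕ.* sum (map r xs))
  sum≤fromℕ-sum d f r [] _ = fromℕ-mono-≤ z≤n
  sum≤fromℕ-sum d f r (x ∷ xs) f≤ =
    ≤-trans (+-mono-≤ (f≤ (here refl)) (sum≤fromℕ-sum d f r xs (f≤ ∘ there)))
            (≤-reflexive (trans (sym (fromℕ-+ (d ℕ.* r x) (d ℕ.* sum (map r xs))))
                                (cong fromℕ (sym (ℕ.*-distribˡ-+ d (r x) (sum (map r xs)))))))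

  module RankBound (d : ℕ) (outdegree≤d : ∀ v → length (outNbrs v) ℕ.≤ d)
                   {lam : Fin n → ℤ} (eff : EffectivelyDecreasing lam) where

    values : List ℤ
    values = deduplicate ℤ._≟_ (map lam (allFin n))

    rank : Fin n → ℕ
    rank x = length (filter (ℤ._≤? lam x) values)

    rank-mono : ∀ {x y} → lam y ℤ.≤ lam x → rank y ℕ.≤ rank x
    rank-mono y≤x = length-filter-mono (ℤ._≤? _) (ℤ._≤? _) (λ _ z≤y → ℤ.≤-trans z≤y y≤x) values

    rank-strict : ∀ {x y} → lam y ℤ.< lam x → rank y ℕ.< rank x
    rank-strict {x} {y} y<x =
      length-filter-strict (ℤ._≤? _) (ℤ._≤? _) (λ _ z≤y → ℤ.≤-trans z≤y (ℤ.<⇒≤ y<x))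
        (∈-deduplicate⁺ ℤ._≟_ (∈-map⁺ lam (∈-allFin x))) ℤ.≤-refl (ℤ.<⇒≱ y<x)

    rank≤imageSize : ∀ x → rank x ℕ.≤ imageSize lam
    rank≤imageSize x = length-filter (ℤ._≤? lam x) values

    expectedTrunc≤d*rank : ∀ k x → expectedTrunc k x ≤ fromℕ (d ℕ.* rank x)
    expectedTrunc≤d*rank zero x = fromℕ-mono-≤ z≤n
    expectedTrunc≤d*rank (suc k) x with outNbrs x in eq
    ... | [] = fromℕ-mono-≤ z≤n
    ... | w ∷ ws = 1+average≤ (length ws) (d ℕ.* sum (map rank (w ∷ ws))) (d ℕ.* rank x)
          (sum≤fromℕ-sum d (expectedTrunc k) rank (w ∷ ws) (λ {y} _ → expectedTrunc≤d*rank k y))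
          weighted
      where
      L = suc (length ws)
      S = sum (map rank (w ∷ ws))
      arc-to : ∀ {y} → y ∈ w ∷ ws → Arc x y
      arc-to {y} y∈ = ∈-outNbrs⁻ (subst (y ∈_) (sym eq) y∈)
      L≤d : L ℕ.≤ d
      L≤d = subst (λ ys → length ys ℕ.≤ d) eq (outdegree≤d x)
      descent = proj₂ eff x (λ sink → sink w (arc-to (here refl)))
      1+S≤L*rank : suc S ℕ.≤ L ℕ.* rank x
      1+S≤L*rank = sum-map-< rank (w ∷ ws) (λ y∈ → rank-mono (proj₁ eff x _ (arc-to y∈)))
        (subst (proj₁ descent ∈_) eq (∈-outNbrs⁺ (proj₁ (proj₂ descent))))
        (rank-strict (proj₂ (proj₂ descent)))
      weighted : L ℕ.+ d ℕ.* S ℕ.≤ L ℕ.* (d ℕ.* rank x)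
      weighted = begin
        L ℕ.+ d ℕ.* S        ≤⟨ ℕ.+-monoˡ-≤ (d ℕ.* S) L≤d ⟩
        d ℕ.+ d ℕ.* S        ≡⟨ ℕ.*-suc d S ⟨
        d ℕ.* suc S          ≤⟨ ℕ.*-monoʳ-≤ d 1+S≤L*rank ⟩
        d ℕ.* (L ℕ.* rank x) ≡⟨ ℕ.*-assoc d L (rank x) ⟨
        d ℕ.* L ℕ.* rank x   ≡⟨ cong (ℕ._* rank x) (ℕ.*-comm d L) ⟩
        L ℕ.* d ℕ.* rank x   ≡⟨ ℕ.*-assoc L d (rank x) ⟩
        L ℕ.* (d ℕ.* rank x) ∎
        where open ℕ.≤-Reasoning

module RationalFacts where
  open import Data.Rational
  open import Data.Rational.Properties
  open import Data.Rational.Solver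
  open import Data.Sum using (_⊎_; inj₁; inj₂)
  open import Relation.Nullary using (¬_; yes; no)
  open import Relation.Binary.PropositionalEquality
  open +-*-Solver

  p≤q⇒0≤q-p : ∀ {p q} → p ≤ q → 0ℚ ≤ q - p
  p≤q⇒0≤q-p {p} {q} p≤q = subst (_≤ q - p) (+-inverseʳ p) (+-monoˡ-≤ (- p) p≤q)

  p≤q⇒p-q≤0 : ∀ {p q} → p ≤ q → p - q ≤ 0ℚ
  p≤q⇒p-q≤0 {p} {q} p≤q = subst (p - q ≤_) (+-inverseʳ q) (+-monoˡ-≤ (- q) p≤q)

  p<q⇒0<q-p : ∀ {p q} → p < q → 0ℚ < q - p
  p<q⇒0<q-p {p} {q} p<q = subst (_< q - p) (+-inverseʳ p) (+-monoˡ-< (- p) p<q)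

  0≤q-p⇒p≤q : ∀ {p q} → 0ℚ ≤ q - p → p ≤ q
  0≤q-p⇒p≤q {p} {q} 0≤q-p =
    subst₂ _≤_ (+-identityˡ p) (solve 2 (λ p q → (q :- p) :+ p := q) refl p q) (+-monoˡ-≤ p 0≤q-p)

  q-p≡0⇒p≡q : ∀ {p q} → q - p ≡ 0ℚ → p ≡ q
  q-p≡0⇒p≡q {p} {q} q-p≡0 =
    sym (trans (solve 2 (λ p q → q := (q :- p) :+ p) refl p q) (trans (cong (_+ p) q-p≡0) (+-identityˡ p)))

  0≤∧≯0⇒≡0 : ∀ {p} → 0ℚ ≤ p → ¬ 0ℚ < p → p ≡ 0ℚ
  0≤∧≯0⇒≡0 0≤p p≯0 = ≤-antisym (≮⇒≥ p≯0) 0≤p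

  0≤p*p : ∀ p → 0ℚ ≤ p * p
  0≤p*p p with ≤-total 0ℚ p
  ... | inj₁ 0≤p = subst (_≤ p * p) (*-zeroʳ p) (*-monoˡ-≤-nonNeg p {{nonNegative 0≤p}} 0≤p)
  ... | inj₂ p≤0 = subst (_≤ p * p) (*-zeroʳ p) (*-monoˡ-≤-nonPos p {{nonPositive p≤0}} p≤0)

  t*q≡p⇒q≡1/t*p : ∀ {t p q} .{{_ : NonZero t}} → t * q ≡ p → q ≡ 1/ t * p
  t*q≡p⇒q≡1/t*p {t} {p} {q} tq≡p = begin
    q              ≡⟨ *-identityˡ q ⟨
    1ℚ * q         ≡⟨ cong (_* q) (*-inverseˡ t) ⟨
    1/ t * t * q   ≡⟨ *-assoc (1/ t) t q ⟩
    1/ t * (t * q) ≡⟨ cong (1/ t *_) tq≡p ⟩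
    1/ t * p       ∎
    where open ≡-Reasoning

  p≢0∧p*q≡0⇒q≡0 : ∀ {p q} → p ≢ 0ℚ → p * q ≡ 0ℚ → q ≡ 0ℚ
  p≢0∧p*q≡0⇒q≡0 {p} {q} p≢0 pq≡0 = trans (t*q≡p⇒q≡1/t*p {p} {0ℚ} {q} pq≡0) (*-zeroʳ (1/ p))
    where instance _ = ≢-nonZero p≢0

  p*p≡0⇒p≡0 : ∀ {p} → p * p ≡ 0ℚ → p ≡ 0ℚ
  p*p≡0⇒p≡0 {p} p*p≡0 with p ≟ 0ℚ
  ... | yes p≡0 = p≡0
  ... | no p≢0 = p≢0∧p*q≡0⇒q≡0 p≢0 p*p≡0

  0≤p*q : ∀ {p q} → 0ℚ ≤ p → 0ℚ ≤ q → 0ℚ ≤ p * q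
  0≤p*q {p} {q} 0≤p 0≤q =
    nonNegative⁻¹ (p * q) {{nonNeg*nonNeg⇒nonNeg p {{nonNegative 0≤p}} q {{nonNegative 0≤q}}}}

  p≡0⊎q≡0⇒p*q≡0 : ∀ {p q} → p ≡ 0ℚ ⊎ q ≡ 0ℚ → p * q ≡ 0ℚ
  p≡0⊎q≡0⇒p*q≡0 {q = q} (inj₁ refl) = *-zeroˡ q
  p≡0⊎q≡0⇒p*q≡0 {p = p} (inj₂ refl) = *-zeroʳ p

  0≤p+q : ∀ {p q} → 0ℚ ≤ p → 0ℚ ≤ q → 0ℚ ≤ p + q
  0≤p+q {p} {q} 0≤p 0≤q = subst (_≤ p + q) (+-identityʳ 0ℚ) (+-mono-≤ 0≤p 0≤q)

  p+q≡0⇒p≡0 : ∀ {p q} → 0ℚ ≤ p → 0ℚ ≤ q → p + q ≡ 0ℚ → p ≡ 0ℚ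
  p+q≡0⇒p≡0 {p} {q} 0≤p 0≤q p+q≡0 =
    ≤-antisym (subst₂ _≤_ (+-identityʳ p) p+q≡0 (+-monoʳ-≤ p 0≤q)) 0≤p

  p+q≡0⇒q≡0 : ∀ {p q} → 0ℚ ≤ p → 0ℚ ≤ q → p + q ≡ 0ℚ → q ≡ 0ℚ
  p+q≡0⇒q≡0 {p} {q} 0≤p 0≤q p+q≡0 = p+q≡0⇒p≡0 0≤q 0≤p (trans (+-comm q p) p+q≡0)

  0≤x-t*y : ∀ {t x y} → 0ℚ ≤ t → 0ℚ ≤ x → (0ℚ < y → t * y ≤ x) → 0ℚ ≤ x - t * y
  0≤x-t*y {t} {x} {y} 0≤t 0≤x ty≤x with 0ℚ <? y
  ... | yes y>0 = p≤q⇒0≤q-p (ty≤x y>0)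
  ... | no y≯0  = p≤q⇒0≤q-p (≤-trans t*y≤0 0≤x)
    where
    t*y≤0 : t * y ≤ 0ℚ
    t*y≤0 = subst (t * y ≤_) (*-zeroʳ t) (*-monoˡ-≤-nonNeg t {{nonNegative 0≤t}} (≮⇒≥ y≯0))

  0≤x+t*y : ∀ {t x y} → 0ℚ ≤ t → 0ℚ ≤ x → (y < 0ℚ → - x ≤ t * y) → 0ℚ ≤ x + t * y
  0≤x+t*y {t} {x} {y} 0≤t 0≤x -x≤ty with y <? 0ℚ
  ... | yes y<0 = subst (_≤ x + t * y) (+-inverseʳ x) (+-monoʳ-≤ x (-x≤ty y<0))
  ... | no y≮0  =
    0≤p+q 0≤x (subst (_≤ t * y) (*-zeroʳ t) (*-monoˡ-≤-nonNeg t {{nonNegative 0≤t}} (≮⇒≥ y≮0)))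

module FinSum where
  open import Data.Nat using (zero; suc)
  open import Data.Fin using (Fin; zero; suc)
  open import Data.Fin.Properties using () renaming (_≟_ to _≟ᶠ_)
  open import Data.Bool using (true; false; if_then_else_)
  open import Data.Rational
  open import Data.Rational.Properties
  open import Data.Rational.Solver
  open import Function using (_∘_)
  open import Relation.Nullary using (does)
  open import Relation.Binary.PropositionalEquality
  open import Algebra.Bundles using (Ring)
  open import Algebra.Properties.Semiring.Sum (Ring.semiring +-*-ring) public using (sum)
  open RationalFacts
  open +-*-Solver

  sum-zero : ∀ {m} (f : Fin m → ℚ) → (∀ k → f k ≡ 0ℚ) → sum f ≡ 0ℚ
  sum-zero {zero}  f _   = refl
  sum-zero {suc m} f f≡0 rewrite f≡0 zero | sum-zero (f ∘ suc) (f≡0 ∘ suc) = refl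

  0≤sum : ∀ {m} {f : Fin m → ℚ} → (∀ k → 0ℚ ≤ f k) → 0ℚ ≤ sum f
  0≤sum {zero}  _   = ≤-refl
  0≤sum {suc m} 0≤f = 0≤p+q (0≤f zero) (0≤sum (0≤f ∘ suc))

  sum≡0⇒≡0 : ∀ {m} {f : Fin m → ℚ} → (∀ k → 0ℚ ≤ f k) → sum f ≡ 0ℚ → ∀ k → f k ≡ 0ℚ
  sum≡0⇒≡0 {suc m} 0≤f Σ≡0 zero    = p+q≡0⇒p≡0 (0≤f zero) (0≤sum (0≤f ∘ suc)) Σ≡0
  sum≡0⇒≡0 {suc m} 0≤f Σ≡0 (suc k) =
    sum≡0⇒≡0 (0≤f ∘ suc) (p+q≡0⇒q≡0 (0≤f zero) (0≤sum (0≤f ∘ suc)) Σ≡0) k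

  single : ∀ {m} → Fin m → ℚ → Fin m → ℚ
  single k x l = if does (k ≟ᶠ l) then x else 0ℚ

  0≤single : ∀ {m} (k : Fin m) {x} → 0ℚ ≤ x → ∀ l → 0ℚ ≤ single k x l
  0≤single k 0≤x l with does (k ≟ᶠ l)
  ... | true  = 0≤x
  ... | false = ≤-refl

  sum-single : ∀ {m} k x (h : Fin m → ℚ) → sum (λ l → single k x l * h l) ≡ x * h k
  sum-single {suc m} zero x h =
    trans (cong (x * h zero +_) (sum-zero _ (λ l → *-zeroˡ (h (suc l))))) (+-identityʳ (x * h zero))
  sum-single {suc m} (suc k) x h =
    trans (cong₂ _+_ (*-zeroˡ (h zero)) (sum-single k x (h ∘ suc))) (+-identityˡ (x * h (suc k)))

  sum-+-* : ∀ {m} (μ ν h : Fin m → ℚ) t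
    → sum (λ k → (μ k + t * ν k) * h k) ≡ sum (λ k → μ k * h k) + t * sum (λ k → ν k * h k)
  sum-+-* {zero}  μ ν h t = solve 1 (λ t → con 0ℚ := con 0ℚ :+ t :* con 0ℚ) refl t
  sum-+-* {suc m} μ ν h t rewrite sum-+-* (μ ∘ suc) (ν ∘ suc) (h ∘ suc) t =
    solve 6 (λ t μ ν h A B → (μ :+ t :* ν) :* h :+ (A :+ t :* B) := (μ :* h :+ A) :+ t :* (ν :* h :+ B))
      refl t (μ zero) (ν zero) (h zero) (sum (λ k → μ (suc k) * h (suc k)))
      (sum (λ k → ν (suc k) * h (suc k)))

module LinearAlgebra where
  open import Data.Nat using (zero; suc)
  open import Data.Fin using (Fin; zero; suc; punchIn; punchOut)
  open import Data.Fin.Properties using (any?; punchIn-punchOut) renaming (_≟_ to _≟ᶠ_)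
  open import Data.Rational
  open import Data.Rational.Properties
  open import Data.Rational.Solver
  open import Data.Vec using (Vec; []; _∷_; zipWith; map; replicate; head; tail)
  open import Data.Vec.Properties using (∷-injectiveˡ; ∷-injectiveʳ)
  open import Data.Product using (∃; _×_; _,_; proj₁; proj₂)
  open import Relation.Nullary using (yes; no; ¬?)
  open import Relation.Nullary.Decidable using (decidable-stable)
  open import Relation.Nullary.Negation using (¬∃⟶∀¬)
  open import Function using (_∘_)
  open import Relation.Binary.PropositionalEquality
  open RationalFacts
  open FinSum using (sum)
  open +-*-Solver

  infixl 6 _+ᵛ_
  infixr 7 _·ᵛ_
  infix 8 _∙_

  _∙_ : ∀ {m} → Vec ℚ m → Vec ℚ m → ℚ
  [] ∙ [] = 0ℚ
  (x ∷ xs) ∙ (y ∷ ys) = x * y + xs ∙ ys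

  _+ᵛ_ : ∀ {m} → Vec ℚ m → Vec ℚ m → Vec ℚ m
  _+ᵛ_ = zipWith _+_

  _·ᵛ_ : ∀ {m} → ℚ → Vec ℚ m → Vec ℚ m
  t ·ᵛ x = map (t *_) x

  0ᵛ : ∀ {m} → Vec ℚ m
  0ᵛ = replicate _ 0ℚ

  ∙-+ᵛ-·ᵛ : ∀ {m} (x : Vec ℚ m) t y p → (x +ᵛ t ·ᵛ y) ∙ p ≡ x ∙ p + t * (y ∙ p)
  ∙-+ᵛ-·ᵛ [] t [] [] = sym (solve 1 (λ t → con 0ℚ :+ t :* con 0ℚ := con 0ℚ) refl t)
  ∙-+ᵛ-·ᵛ (x ∷ xs) t (y ∷ ys) (p ∷ ps) rewrite ∙-+ᵛ-·ᵛ xs t ys ps =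
    solve 6 (λ x t y p A B → (x :+ t :* y) :* p :+ (A :+ t :* B) := (x :* p :+ A) :+ t :* (y :* p :+ B))
      refl x t y p (xs ∙ ps) (ys ∙ ps)

  ∙-·ᵛ : ∀ {m} t (x p : Vec ℚ m) → (t ·ᵛ x) ∙ p ≡ t * (x ∙ p)
  ∙-·ᵛ t [] [] = sym (*-zeroʳ t)
  ∙-·ᵛ t (x ∷ xs) (p ∷ ps) rewrite ∙-·ᵛ t xs ps =
    solve 4 (λ t x p A → t :* x :* p :+ t :* A := t :* (x :* p :+ A)) refl t x p (xs ∙ ps)

  ∙-zeroˡ : ∀ {m} (p : Vec ℚ m) → 0ᵛ ∙ p ≡ 0ℚ
  ∙-zeroˡ [] = refl
  ∙-zeroˡ (p ∷ ps) rewrite ∙-zeroˡ ps = solve 1 (λ p → con 0ℚ :* p :+ con 0ℚ := con 0ℚ) refl p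

  ∙-zeroʳ : ∀ {m} (x : Vec ℚ m) → x ∙ 0ᵛ ≡ 0ℚ
  ∙-zeroʳ [] = refl
  ∙-zeroʳ (x ∷ xs) rewrite ∙-zeroʳ xs = solve 1 (λ x → x :* con 0ℚ :+ con 0ℚ := con 0ℚ) refl x

  0≤∙-self : ∀ {m} (x : Vec ℚ m) → 0ℚ ≤ x ∙ x
  0≤∙-self [] = ≤-refl
  0≤∙-self (x ∷ xs) = 0≤p+q (0≤p*p x) (0≤∙-self xs)

  ∙-self≡0⇒≡0ᵛ : ∀ {m} (x : Vec ℚ m) → x ∙ x ≡ 0ℚ → x ≡ 0ᵛ
  ∙-self≡0⇒≡0ᵛ [] _ = refl
  ∙-self≡0⇒≡0ᵛ (x ∷ xs) x∙x≡0 = cong₂ _∷_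
    (p*p≡0⇒p≡0 (p+q≡0⇒p≡0 (0≤p*p x) (0≤∙-self xs) x∙x≡0))
    (∙-self≡0⇒≡0ᵛ xs (p+q≡0⇒q≡0 (0≤p*p x) (0≤∙-self xs) x∙x≡0))

  x+-1·y≡0ᵛ⇒x≡y : ∀ {m} (x y : Vec ℚ m) → x +ᵛ (- 1ℚ) ·ᵛ y ≡ 0ᵛ → x ≡ y
  x+-1·y≡0ᵛ⇒x≡y [] [] _ = refl
  x+-1·y≡0ᵛ⇒x≡y (x ∷ xs) (y ∷ ys) eq = cong₂ _∷_
    (sym (q-p≡0⇒p≡q (trans (solve 2 (λ x y → x :- y := x :+ (:- con 1ℚ) :* y) refl x y) (∷-injectiveˡ eq))))
    (x+-1·y≡0ᵛ⇒x≡y xs ys (∷-injectiveʳ eq))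

  lincomb : ∀ {k m} → (Fin k → ℚ) → (Fin k → Vec ℚ m) → Vec ℚ m
  lincomb {zero}  μ a = 0ᵛ
  lincomb {suc k} μ a = lincomb (μ ∘ suc) (a ∘ suc) +ᵛ μ zero ·ᵛ a zero

  ∙-lincomb : ∀ {k m} (μ : Fin k → ℚ) (a : Fin k → Vec ℚ m) p
    → lincomb μ a ∙ p ≡ sum (λ l → μ l * (a l ∙ p))
  ∙-lincomb {zero}  μ a p = ∙-zeroˡ p
  ∙-lincomb {suc k} μ a p = begin
    lincomb μ a ∙ p                          ≡⟨ ∙-+ᵛ-·ᵛ (lincomb (μ ∘ suc) (a ∘ suc)) (μ zero) (a zero) p ⟩
    lincomb (μ ∘ suc) (a ∘ suc) ∙ p + first  ≡⟨ cong (_+ first) (∙-lincomb (μ ∘ suc) (a ∘ suc) p) ⟩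
    rest + first                             ≡⟨ +-comm rest first ⟩
    first + rest                             ∎
    where
    open ≡-Reasoning
    first = μ zero * (a zero ∙ p)
    rest = sum (λ l → μ (suc l) * (a (suc l) ∙ p))

  dot≡∙ : ∀ x y → dot x y ≡ x ∙ y
  dot≡∙ (x₀ ∷ x₁ ∷ x₂ ∷ x₃ ∷ []) (y₀ ∷ y₁ ∷ y₂ ∷ y₃ ∷ []) =
    solve 8 (λ x₀ x₁ x₂ x₃ y₀ y₁ y₂ y₃ →
               x₀ :* y₀ :+ x₁ :* y₁ :+ x₂ :* y₂ :+ x₃ :* y₃
            := x₀ :* y₀ :+ (x₁ :* y₁ :+ (x₂ :* y₂ :+ (x₃ :* y₃ :+ con 0ℚ))))
      refl x₀ x₁ x₂ x₃ y₀ y₁ y₂ y₃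

  nonzero-solution : ∀ m (e : Fin m → Vec ℚ (suc m)) → ∃ λ y → y ≢ 0ᵛ × ∀ i → e i ∙ y ≡ 0ℚ
  nonzero-solution zero e = 1ℚ ∷ [] , (λ 1∷[]≡0ᵛ → 1≢0 (∷-injectiveˡ 1∷[]≡0ᵛ)) , λ ()
  nonzero-solution (suc m) e with any? (λ i → ¬? (head (e i) ≟ 0ℚ))
  ... | no no-pivot = 1ℚ ∷ 0ᵛ , (λ y≡0ᵛ → 1≢0 (∷-injectiveˡ y≡0ᵛ)) , λ i → solves i (e i) (head≡0 i)
    where
    head≡0 : ∀ i → head (e i) ≡ 0ℚ
    head≡0 i = decidable-stable (head (e i) ≟ 0ℚ) (¬∃⟶∀¬ no-pivot i)
    solves : ∀ i (eᵢ : Vec ℚ (suc (suc m))) → head eᵢ ≡ 0ℚ → eᵢ ∙ (1ℚ ∷ 0ᵛ) ≡ 0ℚ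
    solves i (.0ℚ ∷ t) refl rewrite ∙-zeroʳ t = refl
  ... | yes (i , h≢0) = y , (λ y≡0ᵛ → y'≢0ᵛ (∷-injectiveʳ y≡0ᵛ)) , solves
    where
    instance _ = ≢-nonZero h≢0
    h = head (e i)
    t = tail (e i)
    reduce : Vec ℚ (suc (suc m)) → Vec ℚ (suc m)
    reduce eⱼ = tail eⱼ +ᵛ (- (head eⱼ * 1/ h)) ·ᵛ t
    IH = nonzero-solution m (λ l → reduce (e (punchIn i l)))
    y' = proj₁ IH
    y'≢0ᵛ = proj₁ (proj₂ IH)
    y = - (t ∙ y' * 1/ h) ∷ y'
    solves-reduced : ∀ eⱼ → reduce eⱼ ∙ y' ≡ 0ℚ → eⱼ ∙ y ≡ 0ℚ
    solves-reduced (hⱼ ∷ tⱼ) r≡0 = begin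
      hⱼ * - (t ∙ y' * 1/ h) + tⱼ ∙ y'       ≡⟨ solve 4 (λ hⱼ T i Tⱼ → hⱼ :* (:- (T :* i)) :+ Tⱼ
                                                                  := Tⱼ :+ (:- (hⱼ :* i)) :* T)
                                                     refl hⱼ (t ∙ y') (1/ h) (tⱼ ∙ y') ⟩
      tⱼ ∙ y' + (- (hⱼ * 1/ h)) * (t ∙ y')   ≡⟨ ∙-+ᵛ-·ᵛ tⱼ (- (hⱼ * 1/ h)) t y' ⟨
      reduce (hⱼ ∷ tⱼ) ∙ y'                   ≡⟨ r≡0 ⟩
      0ℚ                                      ∎
      where open ≡-Reasoning
    pivot-row : e i ∙ y ≡ 0ℚ
    pivot-row = solves-reduced (e i) (begin
      reduce (e i) ∙ y'                  ≡⟨ ∙-+ᵛ-·ᵛ t (- (h * 1/ h)) t y' ⟩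
      t ∙ y' + (- (h * 1/ h)) * (t ∙ y') ≡⟨ cong (λ u → t ∙ y' + (- u) * (t ∙ y')) (*-inverseʳ h) ⟩
      t ∙ y' + (- 1ℚ) * (t ∙ y')         ≡⟨ solve 1 (λ T → T :+ (:- con 1ℚ) :* T := con 0ℚ) refl (t ∙ y') ⟩
      0ℚ                                 ∎)
      where open ≡-Reasoning
    solves : ∀ j → e j ∙ y ≡ 0ℚ
    solves j with i ≟ᶠ j
    ... | yes refl = pivot-row
    ... | no i≢j   = subst (λ l → e l ∙ y ≡ 0ℚ) (punchIn-punchOut i≢j)
                       (solves-reduced (e (punchIn i (punchOut i≢j))) (proj₂ (proj₂ IH) (punchOut i≢j)))

  orthogonal-to-all-but : ∀ {m} (a : Fin (suc m) → Vec ℚ (suc m)) k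
    → ∃ λ y → y ≢ 0ᵛ × ∀ l → k ≢ l → a l ∙ y ≡ 0ℚ
  orthogonal-to-all-but {m} a k with nonzero-solution m (a ∘ punchIn k)
  ... | y , y≢0ᵛ , ⊥y = y , y≢0ᵛ , λ l k≢l →
    subst (λ l → a l ∙ y ≡ 0ℚ) (punchIn-punchOut k≢l) (⊥y (punchOut k≢l))

  +ᵛ-·ᵛ-orthogonal : ∀ {m} {c d y : Vec ℚ m} {ε} → ε ≢ 0ℚ
    → c ∙ y ≡ 0ℚ → (c +ᵛ ε ·ᵛ d) ∙ y ≡ 0ℚ → d ∙ y ≡ 0ℚ
  +ᵛ-·ᵛ-orthogonal {c = c} {d} {y} {ε} ε≢0 c⊥y c+εd⊥y = p≢0∧p*q≡0⇒q≡0 ε≢0 (begin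
    ε * (d ∙ y)           ≡⟨ +-identityˡ (ε * (d ∙ y)) ⟨
    0ℚ + ε * (d ∙ y)      ≡⟨ cong (_+ ε * (d ∙ y)) c⊥y ⟨
    c ∙ y + ε * (d ∙ y)   ≡⟨ ∙-+ᵛ-·ᵛ c ε d y ⟨
    (c +ᵛ ε ·ᵛ d) ∙ y     ≡⟨ c+εd⊥y ⟩
    0ℚ                    ∎)
    where open ≡-Reasoning

module LineSearch where
  open import Data.Nat using (ℕ)
  open import Data.Fin using (Fin)
  open import Data.Rational
  open import Data.Rational.Properties
  open import Data.Rational.Solver
  open import Data.List using (filter; allFin; tabulate)
  open import Relation.Binary.Bundles using (DecTotalOrder)
  open import Data.List.Extrema (DecTotalOrder.totalOrder ≤-decTotalOrder)
    using (argmin; argmin-all; f[argmin]≤f[xs]; min; min≤xs)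
  open import Data.List.Membership.Propositional.Properties using (∈-filter⁺; ∈-allFin; ∈-tabulate⁺)
  open import Data.List.Relation.Unary.All using (lookup)
  open import Data.List.Relation.Unary.All.Properties using (all-filter; tabulate⁺)
  open import Data.Product using (∃; _×_; _,_)
  open import Function using (id)
  open import Relation.Nullary using (yes; no; contradiction)
  open import Relation.Binary.PropositionalEquality
  open RationalFacts
  open +-*-Solver

  module _ {n : ℕ} (r s : Fin n → ℚ) (0≤r : ∀ j → 0ℚ ≤ r j) where

    record RatioStep : Set where
      field
        t        : ℚ
        0<t      : 0ℚ < t
        0≤r-ts   : ∀ j → 0ℚ ≤ r j - t * s j
        j₀       : Fin n
        0<s₀     : 0ℚ < s j₀
        r-ts₀≡0  : r j₀ - t * s j₀ ≡ 0ℚ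

    min-ratio : (∀ j → 0ℚ < s j → 0ℚ < r j) → ∃ (λ j → 0ℚ < s j) → RatioStep
    min-ratio r>0 (j₁ , s₁>0) = record
      { t = t ; 0<t = 0<t ; 0≤r-ts = 0≤r-ts ; j₀ = j₀ ; 0<s₀ = 0<s₀
      ; r-ts₀≡0 = trans (cong (_-_ (r j₀)) (ratio*s≡r j₀ 0<s₀)) (+-inverseʳ (r j₀)) }
      where
      -- 0ℚ is a junk value: ratio is only consulted where 0 < s j.
      ratio : Fin n → ℚ
      ratio j with 0ℚ <? s j
      ... | yes s>0 = r j * (1/ s j) {{pos⇒nonZero (s j) {{positive s>0}}}}
      ... | no _    = 0ℚ
      ratio*s≡r : ∀ j → 0ℚ < s j → ratio j * s j ≡ r j
      ratio*s≡r j s>0 with 0ℚ <? s j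
      ... | yes s>0 = begin
        r j * 1/ s j * s j   ≡⟨ *-assoc (r j) (1/ s j) (s j) ⟩
        r j * (1/ s j * s j) ≡⟨ cong (r j *_) (*-inverseˡ (s j)) ⟩
        r j * 1ℚ             ≡⟨ *-identityʳ (r j) ⟩
        r j                  ∎
        where
        open ≡-Reasoning
        instance _ = pos⇒nonZero (s j) {{positive s>0}}
      ... | no s≯0 = contradiction s>0 s≯0
      candidates = filter (λ j → 0ℚ <? s j) (allFin n)
      j₀ = argmin ratio j₁ candidates
      0<s₀ : 0ℚ < s j₀
      0<s₀ = argmin-all ratio s₁>0 (all-filter (λ j → 0ℚ <? s j) (allFin n))
      t = ratio j₀
      t≤ratio : ∀ j → 0ℚ < s j → t ≤ ratio j
      t≤ratio j s>0 = lookup (f[argmin]≤f[xs] j₁ candidates) (∈-filter⁺ (λ j → 0ℚ <? s j) (∈-allFin j) s>0)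
      0<t : 0ℚ < t
      0<t = *-cancelʳ-<-nonNeg (s j₀) {{nonNegative (<⇒≤ 0<s₀)}}
              (subst₂ _<_ (sym (*-zeroˡ (s j₀))) (sym (ratio*s≡r j₀ 0<s₀)) (r>0 j₀ 0<s₀))
      0≤r-ts : ∀ j → 0ℚ ≤ r j - t * s j
      0≤r-ts j = 0≤x-t*y (<⇒≤ 0<t) (0≤r j) λ s>0 → subst (t * s j ≤_) (ratio*s≡r j s>0)
        (*-monoʳ-≤-nonNeg (s j) {{nonNegative (<⇒≤ s>0)}} (t≤ratio j s>0))

    perturbation : (∀ j → s j < 0ℚ → 0ℚ < r j) → ∃ λ ε → 0ℚ < ε × ∀ j → 0ℚ ≤ r j + ε * s j
    perturbation r>0 = ε , 0<ε , λ j → 0≤x+t*y (<⇒≤ 0<ε) (0≤r j) λ s<0 →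
        subst (_≤ ε * s j) (bound*s≡-r j s<0) (*-monoʳ-≤-nonPos (s j) {{nonPositive (<⇒≤ s<0)}} (ε≤bound j))
      where
      bound : Fin n → ℚ
      bound j with s j <? 0ℚ
      ... | yes s<0 = r j * (1/ (- s j)) {{pos⇒nonZero (- s j) {{positive (neg-antimono-< s<0)}}}}
      ... | no _    = 1ℚ
      0<bound : ∀ j → 0ℚ < bound j
      0<bound j with s j <? 0ℚ
      ... | yes s<0 = positive⁻¹ _ {{pos*pos⇒pos (r j) {{positive (r>0 j s<0)}} _
                                       {{1/pos⇒pos (- s j) {{positive (neg-antimono-< s<0)}}}}}}
      ... | no _    = positive⁻¹ 1ℚ
      bound*s≡-r : ∀ j → s j < 0ℚ → bound j * s j ≡ - r j
      bound*s≡-r j s<0 with s j <? 0ℚ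
      ... | yes s<0 = begin
        r j * i * s j          ≡⟨ solve 3 (λ r i s → r :* i :* s := :- (r :* (i :* (:- s)))) refl (r j) i (s j) ⟩
        - (r j * (i * - s j))  ≡⟨ cong (λ u → - (r j * u)) (*-inverseˡ (- s j)) ⟩
        - (r j * 1ℚ)           ≡⟨ cong -_ (*-identityʳ (r j)) ⟩
        - r j                  ∎
        where
        open ≡-Reasoning
        instance _ = pos⇒nonZero (- s j) {{positive (neg-antimono-< s<0)}}
        i = 1/ (- s j)
      ... | no s≮0 = contradiction s<0 s≮0
      ε = min 1ℚ (tabulate bound)
      0<ε : 0ℚ < ε
      0<ε = argmin-all id {P = 0ℚ <_} (positive⁻¹ 1ℚ) (tabulate⁺ 0<bound)
      ε≤bound : ∀ j → ε ≤ bound j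
      ε≤bound j = lookup (min≤xs 1ℚ (tabulate bound)) (∈-tabulate⁺ j)

module VertexCone {n : ℕ} (pt : Fin n → ℚ⁴) (v : Fin n) where
  open import Data.Nat as ℕ using (zero; suc)
  open import Data.Nat.Induction using (<-rec)
  open import Data.Fin using (zero; suc)
  open import Data.Fin.Properties using (all?; any?; ¬∀⟶∃¬) renaming (_≟_ to _≟ᶠ_)
  open import Data.Rational
  open import Data.Rational.Properties
  open import Data.Rational.Solver
  open import Data.List using (length; filter; allFin)
  open import Data.List.Membership.Propositional using (_∈_)
  open import Data.List.Membership.Propositional.Properties using (∈-allFin)
  open import Data.List.Relation.Unary.Unique.Propositional using (Unique)
  open import Data.Product using (∃; _×_; _,_; proj₁; proj₂)
  open import Data.Sum using (_⊎_; inj₁; inj₂; [_,_]′)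
  open import Data.Empty using (⊥; ⊥-elim)
  open import Function using (_∘_; case_of_)
  open import Function.Bundles using (Equivalence; mk⇔)
  open import Relation.Nullary using (¬_; yes; no; ¬?; contradiction)
  open import Relation.Nullary.Negation using (¬∃⟶∀¬)
  open import Relation.Nullary.Decidable using (_→-dec_; decidable-stable)
  open import Relation.Unary using (Decidable)
  open import Relation.Binary.PropositionalEquality
  open Polytope pt
  open RationalFacts
  open LinearAlgebra
  open FinSum
  open Counting
  open +-*-Solver

  slack : ℚ⁴ → Fin n → ℚ
  slack c j = dot c (pt v) - dot c (pt j)

  slack-v : ∀ c → slack c v ≡ 0ℚ
  slack-v c = +-inverseʳ (dot c (pt v))

  slack-+ᵛ-·ᵛ : ∀ x t y j → slack (x +ᵛ t ·ᵛ y) j ≡ slack x j + t * slack y j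
  slack-+ᵛ-·ᵛ x t y j rewrite dot≡∙ (x +ᵛ t ·ᵛ y) (pt v) | dot≡∙ (x +ᵛ t ·ᵛ y) (pt j)
                            | ∙-+ᵛ-·ᵛ x t y (pt v) | ∙-+ᵛ-·ᵛ x t y (pt j)
                            | dot≡∙ x (pt v) | dot≡∙ x (pt j) | dot≡∙ y (pt v) | dot≡∙ y (pt j) =
    solve 5 (λ a t b c d → (a :+ t :* b) :- (c :+ t :* d) := (a :- c) :+ t :* (b :- d))
      refl (x ∙ pt v) t (y ∙ pt v) (x ∙ pt j) (y ∙ pt j)

  slack-·ᵛ : ∀ t x j → slack (t ·ᵛ x) j ≡ t * slack x j
  slack-·ᵛ t x j rewrite dot≡∙ (t ·ᵛ x) (pt v) | dot≡∙ (t ·ᵛ x) (pt j)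
                       | ∙-·ᵛ t x (pt v) | ∙-·ᵛ t x (pt j) | dot≡∙ x (pt v) | dot≡∙ x (pt j) =
    solve 3 (λ t a b → t :* a :- t :* b := t :* (a :- b)) refl t (x ∙ pt v) (x ∙ pt j)

  slack-lincomb : ∀ {m} (μ : Fin m → ℚ) a j → slack (lincomb μ a) j ≡ sum (λ k → μ k * slack (a k) j)
  slack-lincomb {zero}  μ a j
    rewrite dot≡∙ 0ᵛ (pt v) | dot≡∙ 0ᵛ (pt j) | ∙-zeroˡ (pt v) | ∙-zeroˡ (pt j) = refl
  slack-lincomb {suc m} μ a j = begin
    slack (lincomb μ a) j                           ≡⟨ slack-+ᵛ-·ᵛ (lincomb (μ ∘ suc) (a ∘ suc)) (μ zero) (a zero) j ⟩
    slack (lincomb (μ ∘ suc) (a ∘ suc)) j + first   ≡⟨ cong (_+ first) (slack-lincomb (μ ∘ suc) (a ∘ suc) j) ⟩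
    rest + first                                    ≡⟨ +-comm rest first ⟩
    first + rest                                    ∎
    where
    open ≡-Reasoning
    first = μ zero * slack (a zero) j
    rest = sum (λ k → μ (suc k) * slack (a (suc k)) j)

  -- A record rather than a function type, so that c can be inferred from a proof.
  record Supporting (c : ℚ⁴) : Set where
    constructor supporting
    field 0≤slack : ∀ j → 0ℚ ≤ slack c j
  open Supporting public

  InFace⇒supporting : ∀ {c} → InFace c v → Supporting c
  InFace⇒supporting c∈ = supporting λ j → p≤q⇒0≤q-p (c∈ j)

  supporting⇒InFace : ∀ {c} → Supporting c → InFace c v
  supporting⇒InFace supp j = 0≤q-p⇒p≤q (0≤slack supp j)

  InFace? : ∀ c → Decidable (InFace c)
  InFace? c i = all? (λ j → dot c (pt j) ≤? dot c (pt i))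

  module _ {c} (supp : Supporting c) where

    InFace⇒slack≡0 : ∀ {j} → InFace c j → slack c j ≡ 0ℚ
    InFace⇒slack≡0 {j} c∋j = ≤-antisym (p≤q⇒p-q≤0 (c∋j v)) (0≤slack supp j)

    slack≡0⇒InFace : ∀ {j} → slack c j ≡ 0ℚ → InFace c j
    slack≡0⇒InFace {j} slack≡0 k = subst (dot c (pt k) ≤_) (sym (q-p≡0⇒p≡q slack≡0)) (supporting⇒InFace supp k)

    ¬InFace⇒slack>0 : ∀ {j} → ¬ InFace c j → 0ℚ < slack c j
    ¬InFace⇒slack>0 {j} c∌j with 0ℚ <? slack c j
    ... | yes slack>0 = slack>0
    ... | no slack≯0  = contradiction (slack≡0⇒InFace (0≤∧≯0⇒≡0 (0≤slack supp j) slack≯0)) c∌j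

    slack>0⇒¬InFace : ∀ {j} → 0ℚ < slack c j → ¬ InFace c j
    slack>0⇒¬InFace slack>0 c∋j = <-irrefl (sym (InFace⇒slack≡0 c∋j)) slack>0

  #offFace : ℚ⁴ → ℕ
  #offFace c = length (filter (λ j → 0ℚ <? slack c j) (allFin n))

  #offFace-< : ∀ {c c'} → Supporting c → Supporting c' → (∀ j → InFace c j → InFace c' j)
    → ∀ {i} → InFace c' i → ¬ InFace c i → #offFace c' ℕ.< #offFace c
  #offFace-< supp supp' c⊆c' c'∋i c∌i = length-filter-strict _ _
    (λ j slack'>0 → ¬InFace⇒slack>0 supp (slack>0⇒¬InFace supp' slack'>0 ∘ c⊆c' j))
    (∈-allFin _) (¬InFace⇒slack>0 supp c∌i) (λ slack'>0 → slack>0⇒¬InFace supp' slack'>0 c'∋i)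

  tilted : ℚ⁴ → ℚ → ℚ⁴ → ℚ⁴
  tilted r t s = r +ᵛ (- t) ·ᵛ s

  slack-tilted : ∀ r t s j → slack (tilted r t s) j ≡ slack r j - t * slack s j
  slack-tilted r t s j = trans (slack-+ᵛ-·ᵛ r (- t) s j) (cong (slack r j +_) (sym (neg-distribˡ-* t (slack s j))))

  record Tilt (r s : ℚ⁴) : Set where
    field
      t          : ℚ
      0<t        : 0ℚ < t
      supp-tilted : Supporting (tilted r t s)
      grows      : ∀ j → InFace r j → InFace (tilted r t s) j
      j₀         : Fin n
      r∌j₀       : ¬ InFace r j₀
      tilted∋j₀  : InFace (tilted r t s) j₀

  tilt : ∀ {r s} → Supporting r → Supporting s → (∀ j → InFace r j → InFace s j) → ∃ (λ j → ¬ InFace s j)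
    → Tilt r s
  tilt {r} {s} supp-r supp-s r⊆s (j , s∌j) = record
    { t = t ; 0<t = 0<t
    ; supp-tilted = supp-t
    ; grows = λ j r∋j → slack≡0⇒InFace supp-t (begin
        slack (tilted r t s) j     ≡⟨ slack-tilted r t s j ⟩
        slack r j - t * slack s j  ≡⟨ cong₂ (λ x y → x - t * y) (InFace⇒slack≡0 supp-r r∋j)
                                                               (InFace⇒slack≡0 supp-s (r⊆s j r∋j)) ⟩
        0ℚ - t * 0ℚ                ≡⟨ solve 1 (λ t → con 0ℚ :- t :* con 0ℚ := con 0ℚ) refl t ⟩
        0ℚ                         ∎)
    ; j₀ = j₀ ; r∌j₀ = slack>0⇒¬InFace supp-r (r>0 j₀ 0<s₀)
    ; tilted∋j₀ = slack≡0⇒InFace supp-t (trans (slack-tilted r t s j₀) r-ts₀≡0)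
    }
    where
    open ≡-Reasoning
    r>0 : ∀ j → 0ℚ < slack s j → 0ℚ < slack r j
    r>0 j s>0 = ¬InFace⇒slack>0 supp-r (slack>0⇒¬InFace supp-s s>0 ∘ r⊆s j)
    open LineSearch.RatioStep (LineSearch.min-ratio (slack r) (slack s) (0≤slack supp-r) r>0
                                                    (j , ¬InFace⇒slack>0 supp-s s∌j))
    supp-t : Supporting (tilted r t s)
    supp-t = supporting (λ j → subst (0ℚ ≤_) (sym (slack-tilted r t s j)) (0≤r-ts j))

  record LargerFace (c : ℚ⁴) : Set where
    field
      c'      : ℚ⁴
      ⊇       : ∀ i → InFace c i → InFace c' i
      new     : Fin n
      c'∋new  : InFace c' new
      c∌new   : ¬ InFace c new
      proper  : ∃ λ j → ¬ InFace c' j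

  ¬facet⇒¬¬LargerFace : ∀ {c} → ∃ (λ j → ¬ InFace c j) → ¬ IsFacet c → ¬ ¬ LargerFace c
  ¬facet⇒¬¬LargerFace {c} off ¬facet ¬larger = ¬facet (off , maximal)
    where
    maximal : ∀ c' → (∀ i → InFace c i → InFace c' i) → SameFace c' c ⊎ (∀ i → InFace c' i)
    maximal c' c⊆c' with all? (InFace? c')
    ... | yes full = inj₂ full
    ... | no ¬full with all? (λ i → InFace? c' i →-dec InFace? c i)
    ...   | yes c'⊆c = inj₁ (λ i → mk⇔ (c'⊆c i) (c⊆c' i))
    ...   | no ¬c'⊆c = contradiction (record
      { c' = c' ; ⊇ = c⊆c' ; new = new ; c'∋new = c'∋new ; c∌new = c∌new
      ; proper = ¬∀⟶∃¬ n _ (InFace? c') ¬full }) ¬larger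
      where
      witness = ¬∀⟶∃¬ n _ (λ i → InFace? c' i →-dec InFace? c i) ¬c'⊆c
      new = proj₁ witness
      c'∋new : InFace c' new
      c'∋new with InFace? c' new
      ... | yes c'∋ = c'∋
      ... | no c'∌ = contradiction (λ c'∋ → contradiction c'∋ c'∌) (proj₂ witness)
      c∌new : ¬ InFace c new
      c∌new c∋ = proj₂ witness (λ _ → c∋)

  module Cone {m : ℕ} (a : Fin m → ℚ⁴) where

    -- c is a nonnegative combination of the a k up to a vector orthogonal to P − pt v.
    record InCone (c : ℚ⁴) : Set where
      field
        μ      : Fin m → ℚ
        0≤μ    : ∀ k → 0ℚ ≤ μ k
        slack≡ : ∀ j → slack c j ≡ sum (λ k → μ k * slack (a k) j)

    InCone-zero : ∀ {c} → (∀ j → slack c j ≡ 0ℚ) → InCone c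
    InCone-zero slack≡0 = record
      { μ = λ _ → 0ℚ ; 0≤μ = λ _ → ≤-refl
      ; slack≡ = λ j → trans (slack≡0 j) (sym (sum-zero _ (λ k → *-zeroˡ (slack (a k) j)))) }

    InCone-multiple : ∀ {c} k {t} → 0ℚ ≤ t → (∀ j → slack c j ≡ t * slack (a k) j) → InCone c
    InCone-multiple k {t} 0≤t slack≡t* = record
      { μ = single k t ; 0≤μ = 0≤single k 0≤t
      ; slack≡ = λ j → trans (slack≡t* j) (sym (sum-single k t (λ l → slack (a l) j))) }

    InCone-+ : ∀ {c c₁ c₂ t} → InCone c₁ → InCone c₂ → 0ℚ ≤ t
      → (∀ j → slack c j ≡ slack c₁ j + t * slack c₂ j) → InCone c
    InCone-+ {t = t} rep₁ rep₂ 0≤t slack≡+ = record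
      { μ = λ k → μ₁ k + t * μ₂ k
      ; 0≤μ = λ k → 0≤p+q (0≤μ₁ k) (0≤p*q 0≤t (0≤μ₂ k))
      ; slack≡ = λ j → trans (slack≡+ j) (trans (cong₂ (λ x y → x + t * y) (slack≡₁ j) (slack≡₂ j))
                                          (sym (sum-+-* μ₁ μ₂ (λ k → slack (a k) j) t))) }
      where
      open InCone rep₁ renaming (μ to μ₁; 0≤μ to 0≤μ₁; slack≡ to slack≡₁)
      open InCone rep₂ renaming (μ to μ₂; 0≤μ to 0≤μ₂; slack≡ to slack≡₂)

    module _ {c} (rep : InCone c) where
      open InCone rep

      slack≡0-if-unsupported : ∀ {j} → (∀ k → μ k ≡ 0ℚ ⊎ slack (a k) j ≡ 0ℚ) → slack c j ≡ 0ℚ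
      slack≡0-if-unsupported {j} vanish = trans (slack≡ j) (sum-zero _ (λ k → p≡0⊎q≡0⇒p*q≡0 (vanish k)))

      μ≡0-off-face : (∀ k → Supporting (a k)) → ∀ {j} → slack c j ≡ 0ℚ → ∀ k → 0ℚ < slack (a k) j → μ k ≡ 0ℚ
      μ≡0-off-face supp {j} slack≡0 k slack>0 = p≢0∧p*q≡0⇒q≡0 (λ eq → <-irrefl (sym eq) slack>0)
        (trans (*-comm (slack (a k) j) (μ k))
          (sum≡0⇒≡0 (λ l → 0≤p*q (0≤μ l) (0≤slack (supp l) j)) (trans (sym (slack≡ j)) slack≡0) k))

      InCone⇒≡lincomb : FullDimensional → c ≡ lincomb μ a
      InCone⇒≡lincomb full-dim =
        x+-1·y≡0ᵛ⇒x≡y c (lincomb μ a) (full-dim d λ i j → trans (level i) (sym (level j)))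
        where
        d = c +ᵛ (- 1ℚ) ·ᵛ lincomb μ a
        slack-d≡0 : ∀ j → slack d j ≡ 0ℚ
        slack-d≡0 j = begin
          slack d j                                  ≡⟨ slack-+ᵛ-·ᵛ c (- 1ℚ) (lincomb μ a) j ⟩
          slack c j + (- 1ℚ) * slack (lincomb μ a) j ≡⟨ cong₂ (λ x y → x + (- 1ℚ) * y)
                                                              (slack≡ j) (slack-lincomb μ a j) ⟩
          S + (- 1ℚ) * S                             ≡⟨ solve 1 (λ S → S :+ (:- con 1ℚ) :* S := con 0ℚ) refl S ⟩
          0ℚ                                         ∎
          where
          open ≡-Reasoning
          S = sum (λ k → μ k * slack (a k) j)
        level : ∀ j → dot d (pt j) ≡ dot d (pt v)
        level j = q-p≡0⇒p≡q (slack-d≡0 j)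

      ∙≡0-if-unsupported : FullDimensional → ∀ {y} → (∀ k → μ k ≡ 0ℚ ⊎ a k ∙ y ≡ 0ℚ) → c ∙ y ≡ 0ℚ
      ∙≡0-if-unsupported full-dim {y} vanish = begin
        c ∙ y                         ≡⟨ cong (_∙ y) (InCone⇒≡lincomb full-dim) ⟩
        lincomb μ a ∙ y               ≡⟨ ∙-lincomb μ a y ⟩
        sum (λ k → μ k * (a k ∙ y))   ≡⟨ sum-zero _ (λ k → p≡0⊎q≡0⇒p*q≡0 (vanish k)) ⟩
        0ℚ                            ∎
        where open ≡-Reasoning

  module Farkas {m : ℕ} (a : Fin m → ℚ⁴)
                (facet : ∀ k → IsFacet (a k)) (supp : ∀ k → Supporting (a k))
                (complete : ∀ c → IsFacet c → Supporting c → ∃ λ k → SameFace c (a k)) where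
    open Cone a public
    open import Effect.Monad using (RawMonad)
    open import Relation.Nullary.Negation using (¬¬-Monad)
    open import Relation.Nullary.Decidable using (¬¬-excluded-middle)
    open import Level using (0ℓ)
    open RawMonad (¬¬-Monad {a = 0ℓ}) using (pure; _>>=_)

    -- Tilting a k towards c enlarges the face of the facet a k, so the tilted functional is
    -- constant on P: c is a positive multiple of a k.
    facet-InCone : ∀ {c} → Supporting c → IsFacet c → InCone c
    facet-InCone {c} supp-c c-facet@(off , _) with complete c c-facet supp-c
    ... | k , c≈aₖ = [ (λ same → contradiction (Equivalence.to (same j₀) tilted∋j₀) r∌j₀) , proportional ]′
                       (proj₂ (facet k) (tilted (a k) t c) grows)
      where
      open Tilt (tilt (supp k) supp-c (λ j → Equivalence.from (c≈aₖ j)) off)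
      instance t≢0 = pos⇒nonZero t {{positive 0<t}}
      proportional : (∀ i → InFace (tilted (a k) t c) i) → InCone c
      proportional full = InCone-multiple k (<⇒≤ (positive⁻¹ (1/ t) {{1/pos⇒pos t {{positive 0<t}}}})) λ j →
        t*q≡p⇒q≡1/t*p {t} {slack (a k) j} {slack c j}
          (q-p≡0⇒p≡q (trans (sym (slack-tilted (a k) t c j)) (InFace⇒slack≡0 supp-tilted (full j))))

    -- c = tilted c t c' + t c', and both summands have fewer vertices off their face than c.
    larger-face-InCone : ∀ {c} → Supporting c → LargerFace c
      → (∀ {c'} → Supporting c' → #offFace c' ℕ.< #offFace c → ¬ ¬ InCone c') → ¬ ¬ InCone c
    larger-face-InCone {c} supp-c larger ih =
      ih supp-tilted (#offFace-< supp-c supp-tilted grows tilted∋j₀ r∌j₀) >>= λ rep₁ →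
      ih supp-c' (#offFace-< supp-c supp-c' ⊇ c'∋new c∌new) >>= λ rep' →
      pure (InCone-+ rep₁ rep' (<⇒≤ 0<t) λ j →
        trans (solve 3 (λ x t y → x := (x :- t :* y) :+ t :* y) refl (slack c j) t (slack c' j))
              (cong (_+ t * slack c' j) (sym (slack-tilted c t c' j))))
      where
      open LargerFace larger
      supp-c' : Supporting c'
      supp-c' = InFace⇒supporting (⊇ v (supporting⇒InFace supp-c))
      open Tilt (tilt supp-c supp-c' ⊇ proper)

    -- Being a facet is not decidable, so this is proved under double negation; every use of it
    -- proves ⊥.
    in-cone : ∀ {c} → Supporting c → ¬ ¬ InCone c
    in-cone {c} = <-rec P step (#offFace c) refl
      where
      P : ℕ → Set
      P d = ∀ {c} → #offFace c ≡ d → Supporting c → ¬ ¬ InCone c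
      step : ∀ d → (∀ {d'} → d' ℕ.< d → P d') → P d
      step _ ih {c} refl supp-c with any? (λ j → 0ℚ <? slack c j)
      ... | no none-off = pure (InCone-zero λ j → 0≤∧≯0⇒≡0 (0≤slack supp-c j) (λ s>0 → none-off (j , s>0)))
      ... | yes (j , s>0) = ¬¬-excluded-middle >>= λ where
        (yes c-facet) → pure (facet-InCone supp-c c-facet)
        (no ¬c-facet) → ¬facet⇒¬¬LargerFace (j , slack>0⇒¬InFace supp-c s>0) ¬c-facet >>= λ larger →
                        larger-face-InCone supp-c larger (λ supp' lt → ih lt refl supp')

  perturb : ∀ {c} d → Supporting c → (∀ j → slack d j < 0ℚ → 0ℚ < slack c j)
    → ∃ λ ε → 0ℚ < ε × Supporting (c +ᵛ ε ·ᵛ d)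
  perturb {c} d supp-c d<0⇒c>0 with LineSearch.perturbation (slack c) (slack d) (0≤slack supp-c) d<0⇒c>0
  ... | ε , 0<ε , 0≤c+εd =
    ε , 0<ε , supporting λ j → subst (0ℚ ≤_) (sym (slack-+ᵛ-·ᵛ c ε d j)) (0≤c+εd j)

  record Edge (w : Fin n) : Set where
    field
      w≢v       : w ≢ v
      cw        : ℚ⁴
      supp-cw   : Supporting cw
      cw∋w      : slack cw w ≡ 0ℚ
      cw-strict : ∀ j → j ≢ v → j ≢ w → 0ℚ < slack cw j

  Adj⇒Edge : ∀ {w} → Adj v w → Edge w
  Adj⇒Edge {w} (v≢w , c , v~w , strict) = record
    { w≢v = v≢w ∘ sym ; cw = c ; supp-cw = supporting 0≤slack-c ; cw∋w = c∋w
    ; cw-strict = λ j j≢v j≢w → p<q⇒0<q-p (strict j j≢v j≢w) }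
    where
    c∋w : slack c w ≡ 0ℚ
    c∋w = trans (cong (_-_ (dot c (pt v))) (sym v~w)) (+-inverseʳ (dot c (pt v)))
    0≤slack-c : ∀ j → 0ℚ ≤ slack c j
    0≤slack-c j with j ≟ᶠ v | j ≟ᶠ w
    ... | yes refl | _        = ≤-reflexive (sym (slack-v c))
    ... | no _     | yes refl = ≤-reflexive (sym c∋w)
    ... | no j≢v   | no j≢w   = <⇒≤ (p<q⇒0<q-p (strict j j≢v j≢w))

  module Degree (a : Fin 4 → ℚ⁴)
                (facet : ∀ k → IsFacet (a k)) (supp : ∀ k → Supporting (a k))
                (complete : ∀ c → IsFacet c → Supporting c → ∃ λ k → SameFace c (a k))
                (full-dim : FullDimensional)
                (cv : ℚ⁴) (cv-strict : ∀ j → j ≢ v → 0ℚ < slack cv j) where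
    open Farkas a facet supp complete

    supp-cv : Supporting cv
    supp-cv = supporting λ j → case j ≟ᶠ v of λ where
      (yes refl) → ≤-reflexive (sym (slack-v cv))
      (no j≢v)   → <⇒≤ (cv-strict j j≢v)

    -- cv and cv + ε y both lie in the cone, hence are orthogonal to y; so y ∙ y = 0.
    no-common-orthogonal : ∀ {y} → y ≢ 0ᵛ → ¬ (∀ k → a k ∙ y ≡ 0ℚ)
    no-common-orthogonal {y} y≢0ᵛ ⊥y
      with perturb y supp-cv (λ j y<0 → cv-strict j λ { refl → <-irrefl (slack-v y) y<0 })
    ... | ε , 0<ε , supp-cv+εy =
      in-cone supp-cv λ rep → in-cone supp-cv+εy λ rep' →
        y≢0ᵛ (∙-self≡0⇒≡0ᵛ y (+ᵛ-·ᵛ-orthogonal {c = cv} {y} {y} (λ ε≡0 → <-irrefl (sym ε≡0) 0<ε)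
          (∙≡0-if-unsupported rep full-dim (inj₂ ∘ ⊥y)) (∙≡0-if-unsupported rep' full-dim (inj₂ ∘ ⊥y))))

    edge-not-in-all-facets : ∀ {w} → Edge w → ¬ (∀ k → InFace (a k) w)
    edge-not-in-all-facets {w} e a∋w = in-cone supp-cv λ rep →
      <-irrefl (sym (slack≡0-if-unsupported rep (λ k → inj₂ (InFace⇒slack≡0 (supp k) (a∋w k)))))
               (cv-strict w w≢v)
      where open Edge e

    -- The combination g of a k and a k' vanishes at w, so for small ε > 0 also cw + ε g is
    -- maximised at v and w.  Both lie in the cone with zero k-th coefficient, hence are
    -- orthogonal to a vector y ⊥ a l (l ≢ k); so is g, which forces y ⊥ a k as well.
    two-misses-impossible : ∀ {w} → Edge w → ∀ {k k'} → k ≢ k'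
      → ¬ InFace (a k) w → ¬ InFace (a k') w → ⊥
    two-misses-impossible {w} e {k} {k'} k≢k' aₖ∌w aₖ'∌w =
      in-cone supp-cw λ rep → in-cone supp-h λ repₕ → no-common-orthogonal y≢0ᵛ (⊥all rep repₕ)
      where
      open Edge e
      open ≡-Reasoning
      α  = slack (a k) w
      α' = slack (a k') w
      g = α' ·ᵛ a k +ᵛ (- α) ·ᵛ a k'
      slack-g : ∀ j → slack g j ≡ α' * slack (a k) j + (- α) * slack (a k') j
      slack-g j = trans (slack-+ᵛ-·ᵛ (α' ·ᵛ a k) (- α) (a k') j)
                        (cong (_+ (- α) * slack (a k') j) (slack-·ᵛ α' (a k) j))
      g∋w : slack g w ≡ 0ℚ
      g∋w = trans (slack-g w) (solve 2 (λ α α' → α' :* α :+ (:- α) :* α' := con 0ℚ) refl α α')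
      g<0⇒cw>0 : ∀ j → slack g j < 0ℚ → 0ℚ < slack cw j
      g<0⇒cw>0 j g<0 = cw-strict j (λ { refl → <-irrefl (slack-v g) g<0 }) (λ { refl → <-irrefl g∋w g<0 })
      perturbed = perturb g supp-cw g<0⇒cw>0
      ε = proj₁ perturbed
      ε≢0 : ε ≢ 0ℚ
      ε≢0 ε≡0 = <-irrefl (sym ε≡0) (proj₁ (proj₂ perturbed))
      h = cw +ᵛ ε ·ᵛ g
      supp-h : Supporting h
      supp-h = proj₂ (proj₂ perturbed)
      h∋w : slack h w ≡ 0ℚ
      h∋w = begin
        slack h w                  ≡⟨ slack-+ᵛ-·ᵛ cw ε g w ⟩
        slack cw w + ε * slack g w ≡⟨ cong₂ (λ x y → x + ε * y) cw∋w g∋w ⟩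
        0ℚ + ε * 0ℚ                ≡⟨ solve 1 (λ ε → con 0ℚ :+ ε :* con 0ℚ := con 0ℚ) refl ε ⟩
        0ℚ                         ∎
      orthogonal = orthogonal-to-all-but a k
      y = proj₁ orthogonal
      y≢0ᵛ = proj₁ (proj₂ orthogonal)
      y⊥ = proj₂ (proj₂ orthogonal)
      ⊥y-if-w∈ : ∀ {c} → InCone c → slack c w ≡ 0ℚ → c ∙ y ≡ 0ℚ
      ⊥y-if-w∈ rep c∋w = ∙≡0-if-unsupported rep full-dim λ l → case k ≟ᶠ l of λ where
        (yes refl) → inj₁ (μ≡0-off-face rep supp c∋w k (¬InFace⇒slack>0 (supp k) aₖ∌w))
        (no k≢l)   → inj₂ (y⊥ l k≢l)
      g∙y : g ∙ y ≡ α' * (a k ∙ y)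
      g∙y = begin
        g ∙ y                                ≡⟨ ∙-+ᵛ-·ᵛ (α' ·ᵛ a k) (- α) (a k') y ⟩
        (α' ·ᵛ a k) ∙ y + (- α) * (a k' ∙ y) ≡⟨ cong₂ (λ u z → u + (- α) * z)
                                                        (∙-·ᵛ α' (a k) y) (y⊥ k' k≢k') ⟩
        α' * (a k ∙ y) + (- α) * 0ℚ          ≡⟨ solve 2 (λ x u → x :+ u :* con 0ℚ := x)
                                                        refl (α' * (a k ∙ y)) (- α) ⟩
        α' * (a k ∙ y)                       ∎
      ⊥all : InCone cw → InCone h → ∀ l → a l ∙ y ≡ 0ℚ
      ⊥all rep repₕ l with k ≟ᶠ l
      ... | no k≢l   = y⊥ l k≢l
      ... | yes refl = p≢0∧p*q≡0⇒q≡0 (λ α'≡0 → <-irrefl (sym α'≡0) (¬InFace⇒slack>0 (supp k') aₖ'∌w))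
                         (trans (sym g∙y) (+ᵛ-·ᵛ-orthogonal {c = cw} ε≢0
                                                              (⊥y-if-w∈ rep cw∋w) (⊥y-if-w∈ repₕ h∋w)))

    edge-misses-at-most-one : ∀ {w} → Edge w → ∀ {k k'} → k ≢ k' → ¬ InFace (a k) w → InFace (a k') w
    edge-misses-at-most-one {w} e k≢k' aₖ∌w =
      decidable-stable (InFace? (a _) w) (two-misses-impossible e k≢k' aₖ∌w)

    -- zero is a junk value: it is never reached at a neighbour of v.
    missedFacet : Fin n → Fin 4
    missedFacet w with any? (λ k → ¬? (InFace? (a k) w))
    ... | yes (k , _) = k
    ... | no _        = zero

    edge-misses-missedFacet : ∀ {w} → Edge w → ¬ InFace (a (missedFacet w)) w
    edge-misses-missedFacet {w} e with any? (λ k → ¬? (InFace? (a k) w))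
    ... | yes (k , aₖ∌w) = aₖ∌w
    ... | no none =
      ⊥-elim (edge-not-in-all-facets e λ k → decidable-stable (InFace? (a k) w) (¬∃⟶∀¬ none k))

    missedFacet-injective : ∀ {w w'} → Edge w → Edge w' → missedFacet w ≡ missedFacet w' → w ≡ w'
    missedFacet-injective {w} {w'} e e' same with w ≟ᶠ w'
    ... | yes w≡w' = w≡w'
    ... | no w≢w' = ⊥-elim (in-cone supp-cw λ rep →
      <-irrefl (sym (slack≡0-if-unsupported rep (unsupported rep)))
               (cw-strict w' (Edge.w≢v e') (w≢w' ∘ sym)))
      where
      open Edge e
      k = missedFacet w
      unsupported : (rep : InCone cw) → ∀ l → InCone.μ rep l ≡ 0ℚ ⊎ slack (a l) w' ≡ 0ℚ
      unsupported rep l with k ≟ᶠ l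
      ... | yes refl =
        inj₁ (μ≡0-off-face rep supp cw∋w k (¬InFace⇒slack>0 (supp k) (edge-misses-missedFacet e)))
      ... | no k≢l   = inj₂ (InFace⇒slack≡0 (supp l)
        (edge-misses-at-most-one e' (λ eq → k≢l (trans same eq)) (edge-misses-missedFacet e')))

    neighbours≤4 : ∀ {ws} → Unique ws → (∀ {w} → w ∈ ws → Adj v w) → length ws ℕ.≤ 4
    neighbours≤4 unique adj = length≤-injection unique missedFacet λ w∈ w'∈ →
      missedFacet-injective (Adj⇒Edge (adj w∈)) (Adj⇒Edge (adj w'∈))

module SimplePolytope where
  open import Data.Nat using (_≤_)
  open import Data.Fin using (Fin)
  open import Data.List using (List; length)
  open import Data.List.Membership.Propositional using (_∈_)
  open import Data.List.Relation.Unary.Unique.Propositional using (Unique)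
  open import Data.Product using (_,_; proj₁; proj₂)
  open RationalFacts using (p<q⇒0<q-p)

  simple⇒neighbours≤4 : ∀ {n} {pt : Fin n → ℚ⁴} → IsSimple4Polytope pt → ∀ v {ws : List (Fin n)}
    → Unique ws → (∀ {w} → w ∈ ws → Polytope.Adj pt v w) → length ws ≤ 4
  simple⇒neighbours≤4 {pt = pt} (convex , full-dim , simple) v with simple v | convex v
  ... | F , F-facets , _ , complete | cv , cv-strict = neighbours≤4
    where
    open VertexCone pt v
    open Degree F (λ k → proj₁ (F-facets k)) (λ k → InFace⇒supporting (proj₂ (F-facets k)))
      (λ c c-facet supp-c → complete c c-facet (supporting⇒InFace supp-c)) full-dim
      cv (λ j j≢v → p<q⇒0<q-p (cv-strict j j≢v))

  simple⇒outdegree≤4 : ∀ {n} {pt : Fin n → ℚ⁴} → IsSimple4Polytope pt → ∀ arc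
    → (∀ i j → Orientation.Arc arc i j → Polytope.Adj pt i j)
    → ∀ v → length (Orientation.outNbrs arc v) ≤ 4
  simple⇒outdegree≤4 simple arc arc⇒adj v =
    simple⇒neighbours≤4 simple v (outNbrs-unique v) λ w∈ → arc⇒adj v _ (∈-outNbrs⁻ w∈)
    where open RandomEdge arc

open import Data.Nat using (ℕ; _*_)
open import Data.Integer using (ℤ; +_)
open import Data.Rational using (ℚ; _≤_; _/_)
open import Data.Fin using (Fin)
open import Data.Bool using (Bool)

theorem2p2 : (n : ℕ) (pt : Fin n → ℚ⁴) → IsSimple4Polytope pt
    → (arc : Fin n → Fin n → Bool) → IsAUSO pt arc
    → (vst : Fin n) (lam : Fin n → ℤ)
    → Orientation.EffectivelyDecreasing arc lam
    → (k : ℕ) → Orientation.expectedTrunc arc k vst ≤ (+ (4 * imageSize lam)) / 1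
theorem2p2 n pt simple arc auso vst lam eff k = begin
  Orientation.expectedTrunc arc k vst ≤⟨ expectedTrunc≤d*rank k vst ⟩
  fromℕ (4 * rank vst)                ≤⟨ fromℕ-mono-≤ (*-monoʳ-≤ 4 (rank≤imageSize vst)) ⟩
  fromℕ (4 * imageSize lam)           ≡⟨ /1≡fromℕ (4 * imageSize lam) ⟨
  + (4 * imageSize lam) / 1           ∎
  where
  open import Data.Nat.Properties using (*-monoʳ-≤)
  open import Data.Rational.Properties using (module ≤-Reasoning)
  open import Data.Product using (proj₁)
  open ≤-Reasoning
  open NatEmbedding
  open RandomEdge.RankBound arc 4 (SimplePolytope.simple⇒outdegree≤4 simple arc (proj₁ auso)) eff
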